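{- Let $a_1,a_2\ge 0$ and $s\ge 1$ be integers with $a_1+a_2\ge 1$, and let $c=\lfloor (a_1+a_2)/2\rfloor+1$ (this is the guess of the strategy $\mathcal G^*$ at position $a_1+a_2$ of the top half, namely $\lfloor i/2\rfloor+1$ at position $i$). Then $$G(a_1,a_2,s,q)=q^{\delta(c,a_1)}\,G(a_1-1,a_2,s,q)+q^{\delta(c,\,s+a_2-1)}\,G(a_1,a_2-1,s,q),$$ with $G(0,0,s,q)=1$ and with the convention that $G$ is $0$ whenever one of its first two arguments is negative.
   Context: For integers $a_1,a_2\ge 0$ and $s\ge1$, consider the $\binom{a_1+a_2}{a_1}$ sequences $w=(w_1,\dots,w_{a_1+a_2})$ obtained by interleaving (order-preserving merging) the first sequence $(1,2,\dots,a_1)$ and the second sequence $(s,s+1,\dots,s+a_2-1)$; interleavings are distinguished by the set of positions occupied by the first sequence. Define $G(a_1,a_2,s,q)=\sum_w q^{c(w)}$, where $c(w)$ is the number of positions $i$, $1\le i\le a_1+a_2$, with $w_i=\lfloor i/2\rfloor+1$. (In the card-guessing application, these are the possible top halves of a once riffle-shuffled deck whose top half contains $a_1$ cards of the first pile and $a_2$ cards of the second pile starting at value $s$, and $c(w)$ is the number of correct guesses there under the guesses $1,2,2,3,3,\dots$.) $\delta(c,d)$ is the Kronecker delta: $1$ if $c=d$, $0$ otherwise. -}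

module Defs where

open import Data.Nat using (ℕ; zero; suc; _+_; _^_; _≡ᵇ_; _/_)
open import Data.Bool using (Bool; true; false; if_then_else_)
open import Data.List using (List; []; _∷_; [_]; map; _++_)
open import Data.Nat.ListAction using (sum)
open import Data.Integer using (ℤ; +_)

-- All interleavings of a sequence of length a with a sequence of length b,
-- encoded by the list of choices: false = next entry taken from the first
-- sequence, true = next entry taken from the second sequence.
-- (Each interleaving = set of positions of the first sequence appears once.)
shuffles : ℕ → ℕ → List (List Bool)
shuffles zero    zero    = [ [] ]
shuffles zero    (suc b) = map (true ∷_) (shuffles zero b)
shuffles (suc a) zero    = map (false ∷_) (shuffles a zero)
shuffles (suc a) (suc b) =
  map (false ∷_) (shuffles a (suc b)) ++ map (true ∷_) (shuffles (suc a) b)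

word : ℕ → ℕ → List Bool → List ℕ
word x y []            = []
word x y (false ∷ bs)  = x ∷ word (suc x) y bs
word x y (true  ∷ bs)  = y ∷ word x (suc y) bs

correctFrom : ℕ → List ℕ → ℕ
correctFrom i []       = 0
correctFrom i (v ∷ vs) =
  (if v ≡ᵇ (i / 2 + 1) then 1 else 0) + correctFrom (suc i) vs

c : List ℕ → ℕ
c w = correctFrom 1 w

G : ℕ → ℕ → ℕ → ℕ → ℕ
G a₁ a₂ s q = sum (map (λ bs → q ^ c (word 1 s bs)) (shuffles a₁ a₂))

Gℤ : ℤ → ℤ → ℕ → ℕ → ℕ
Gℤ (+ a₁) (+ a₂) s q = G a₁ a₂ s q
Gℤ _      _      _ _ = 0

δ : ℕ → ℕ → ℕ
δ x y = if x ≡ᵇ y then 1 else 0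

-- An interleaving is a lattice path from (0 , 0) to (a₁ , a₂): an east step takes the next
-- card of the first pile, a north step the next card of the second.  The step leaving (a , b)
-- puts the value a + 1 or s + b at position a + b + 1, so q ^ c(w) is the product of weights
-- of the steps of the path and G is a weighted path sum.  Such sums are naturally defined by
-- their first step (as the interleavings are); the theorem is the decomposition by the last
-- step, which holds for arbitrary step weights by induction, the two decompositions
-- commuting with each other.

module Submission where

open import Defs
open import Data.Bool using (Bool; true; false)
open import Data.Integer using (+_) renaming (_-_ to _-ℤ_)
open import Data.List using (List; []; _∷_; map; _++_)
open import Data.List.Properties using (map-++; map-cong)
open import Data.Nat using (ℕ; zero; suc; _+_; _*_; _^_; _∸_; _/_; _≥_)
open import Data.Nat.ListAction using (sum)
open import Data.Nat.ListAction.Properties using (sum-++)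
open import Data.Nat.Properties
  using (+-comm; +-suc; +-identityʳ; *-zeroʳ; *-distribˡ-+; ^-distribˡ-+-*;
         *-commutativeSemigroup)
open import Algebra.Properties.CommutativeSemigroup *-commutativeSemigroup using (x∙yz≈y∙xz)
open import Data.Nat.Tactic.RingSolver using (solve-∀)
open import Data.Product using (_×_; _,_)
open import Relation.Binary.PropositionalEquality
  using (_≡_; refl; sym; trans; cong; cong₂; module ≡-Reasoning)

-- w a b t is the weight of the lattice step leaving (a , b),
-- eastwards (a + 1) for t = false and northwards (b + 1) for t = true.
Weight : Set
Weight = ℕ → ℕ → Bool → ℕ

east north : Weight → Weight
east  w a b = w (suc a) b
north w a b = w a (suc b)

step : Bool → Weight → Weight
step false = east
step true  = north

pathSum : Weight → ℕ → ℕ → ℕ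
pathSum w zero    zero    = 1
pathSum w zero    (suc b) = w 0 0 true  * pathSum (north w) 0 b
pathSum w (suc a) zero    = w 0 0 false * pathSum (east w) a 0
pathSum w (suc a) (suc b) =
  w 0 0 false * pathSum (east w) a (suc b) + w 0 0 true * pathSum (north w) (suc a) b

pathSum-north : ∀ w b → pathSum w 0 (suc b) ≡ w 0 b true * pathSum w 0 b
pathSum-north w zero    = refl
pathSum-north w (suc b) =
  trans (cong (w 0 0 true *_) (pathSum-north (north w) b))
        (x∙yz≈y∙xz (w 0 0 true) (w 0 (suc b) true) (pathSum (north w) 0 b))

pathSum-east : ∀ w a → pathSum w (suc a) 0 ≡ w a 0 false * pathSum w a 0
pathSum-east w zero    = refl
pathSum-east w (suc a) =
  trans (cong (w 0 0 false *_) (pathSum-east (east w) a))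
        (x∙yz≈y∙xz (w 0 0 false) (w (suc a) 0 false) (pathSum (east w) a 0))

pathSum-last : ∀ w a b →
  pathSum w (suc a) (suc b)
    ≡ w a (suc b) false * pathSum w a (suc b) + w (suc a) b true * pathSum w (suc a) b
pathSum-last w zero zero =
  trans (+-comm (w 0 0 false * (w 1 0 true * 1)) (w 0 0 true * (w 0 1 false * 1)))
        (cong₂ _+_ (x∙yz≈y∙xz (w 0 0 true) (w 0 1 false) 1)
                   (x∙yz≈y∙xz (w 0 0 false) (w 1 0 true) 1))
pathSum-last w zero (suc b) =
  trans (cong₂ (λ x y → w 0 0 false * x + w 0 0 true * y)
               (pathSum-north (east w) (suc b)) (pathSum-last (north w) zero b))
        (interchange (w 0 0 false) (w 0 0 true) (w 0 (suc (suc b)) false) (w 1 (suc b) true)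
                     (pathSum (east w) 0 (suc b))
                     (pathSum (north w) 0 (suc b)) (pathSum (north w) 1 b))
  where
  interchange : ∀ f t W₁ W₂ A C D →
    f * (W₂ * A) + t * (W₁ * C + W₂ * D) ≡ W₁ * (t * C) + W₂ * (f * A + t * D)
  interchange = solve-∀
pathSum-last w (suc a) zero =
  trans (cong₂ (λ x y → w 0 0 false * x + w 0 0 true * y)
               (pathSum-last (east w) a zero) (pathSum-east (north w) (suc a)))
        (interchange (w 0 0 false) (w 0 0 true) (w (suc a) 1 false) (w (suc (suc a)) 0 true)
                     (pathSum (east w) a 1) (pathSum (east w) (suc a) 0)
                     (pathSum (north w) (suc a) 0))
  where
  interchange : ∀ f t W₁ W₂ A B C →
    f * (W₁ * A + W₂ * B) + t * (W₁ * C) ≡ W₁ * (f * A + t * C) + W₂ * (f * B)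
  interchange = solve-∀
pathSum-last w (suc a) (suc b) =
  trans (cong₂ (λ x y → w 0 0 false * x + w 0 0 true * y)
               (pathSum-last (east w) a (suc b)) (pathSum-last (north w) (suc a) b))
        (interchange (w 0 0 false) (w 0 0 true)
                     (w (suc a) (suc (suc b)) false) (w (suc (suc a)) (suc b) true)
                     (pathSum (east w) a (suc (suc b))) (pathSum (east w) (suc a) (suc b))
                     (pathSum (north w) (suc a) (suc b)) (pathSum (north w) (suc (suc a)) b))
  where
  interchange : ∀ f t W₁ W₂ A B C D →
    f * (W₁ * A + W₂ * B) + t * (W₁ * C + W₂ * D)
      ≡ W₁ * (f * A + t * C) + W₂ * (f * B + t * D)
  interchange = solve-∀

pathWeight : Weight → List Bool → ℕ
pathWeight w []       = 1
pathWeight w (t ∷ bs) = w 0 0 t * pathWeight (step t w) bs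

pathWeight-cong : ∀ {w v} → (∀ a b t → w a b t ≡ v a b t) →
                  ∀ bs → pathWeight w bs ≡ pathWeight v bs
pathWeight-cong w≗v []           = refl
pathWeight-cong w≗v (false ∷ bs) =
  cong₂ _*_ (w≗v 0 0 false) (pathWeight-cong (λ a → w≗v (suc a)) bs)
pathWeight-cong w≗v (true ∷ bs)  =
  cong₂ _*_ (w≗v 0 0 true) (pathWeight-cong (λ a b → w≗v a (suc b)) bs)

sum-pathWeight-∷ : ∀ w t xs →
  sum (map (pathWeight w) (map (t ∷_) xs)) ≡ w 0 0 t * sum (map (pathWeight (step t w)) xs)
sum-pathWeight-∷ w t []       = sym (*-zeroʳ (w 0 0 t))
sum-pathWeight-∷ w t (x ∷ xs) =
  trans (cong (_+_ (pathWeight w (t ∷ x))) (sum-pathWeight-∷ w t xs))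
        (sym (*-distribˡ-+ (w 0 0 t) _ _))

pathSum≡sum-pathWeight : ∀ w a b → pathSum w a b ≡ sum (map (pathWeight w) (shuffles a b))
pathSum≡sum-pathWeight w zero    zero    = refl
pathSum≡sum-pathWeight w zero    (suc b) =
  trans (cong (w 0 0 true *_) (pathSum≡sum-pathWeight (north w) 0 b))
        (sym (sum-pathWeight-∷ w true (shuffles 0 b)))
pathSum≡sum-pathWeight w (suc a) zero    =
  trans (cong (w 0 0 false *_) (pathSum≡sum-pathWeight (east w) a 0))
        (sym (sum-pathWeight-∷ w false (shuffles a 0)))
pathSum≡sum-pathWeight w (suc a) (suc b) = begin
  pathSum w (suc a) (suc b)
    ≡⟨ cong₂ _+_
         (trans (cong (w 0 0 false *_) (pathSum≡sum-pathWeight (east w) a (suc b)))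
                (sym (sum-pathWeight-∷ w false (shuffles a (suc b)))))
         (trans (cong (w 0 0 true *_) (pathSum≡sum-pathWeight (north w) (suc a) b))
                (sym (sum-pathWeight-∷ w true (shuffles (suc a) b)))) ⟩
  sum (map (pathWeight w) (map (false ∷_) (shuffles a (suc b))))
    + sum (map (pathWeight w) (map (true ∷_) (shuffles (suc a) b)))
    ≡⟨ sum-++ (map (pathWeight w) (map (false ∷_) (shuffles a (suc b))))
              (map (pathWeight w) (map (true ∷_) (shuffles (suc a) b))) ⟨
  sum (map (pathWeight w) (map (false ∷_) (shuffles a (suc b)))
       ++ map (pathWeight w) (map (true ∷_) (shuffles (suc a) b)))
    ≡⟨ cong sum (map-++ (pathWeight w) (map (false ∷_) (shuffles a (suc b)))
                                      (map (true ∷_) (shuffles (suc a) b))) ⟨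
  sum (map (pathWeight w) (shuffles (suc a) (suc b))) ∎
  where open ≡-Reasoning

δ-comm : ∀ m n → δ m n ≡ δ n m
δ-comm zero    zero    = refl
δ-comm zero    (suc n) = refl
δ-comm (suc m) zero    = refl
δ-comm (suc m) (suc n) = δ-comm m n

m+[n+1+o]≡1+m+[n+o] : ∀ m n o → m + (n + suc o) ≡ suc (m + (n + o))
m+[n+1+o]≡1+m+[n+o] m n o = trans (cong (_+_ m) (+-suc n o)) (+-suc m (n + o))

module _ (q : ℕ) where

  hit : ℕ → ℕ → ℕ
  hit i v = q ^ δ (i / 2 + 1) v

  -- Weights for scoring a merge of (x, x+1, …) with (y, y+1, …) from position i on:
  -- the step leaving (a , b) places the value x + a or y + b at position i + a + b.
  scoreWeight : ℕ → ℕ → ℕ → Weight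
  scoreWeight i x y a b false = hit (i + (a + b)) (x + a)
  scoreWeight i x y a b true  = hit (i + (a + b)) (y + b)

  scoreWeight-east : ∀ i x y a b t →
    east (scoreWeight i x y) a b t ≡ scoreWeight (suc i) (suc x) y a b t
  scoreWeight-east i x y a b false = cong₂ hit (+-suc i (a + b)) (+-suc x a)
  scoreWeight-east i x y a b true  = cong (λ n → hit n (y + b)) (+-suc i (a + b))

  scoreWeight-north : ∀ i x y a b t →
    north (scoreWeight i x y) a b t ≡ scoreWeight (suc i) x (suc y) a b t
  scoreWeight-north i x y a b false = cong (λ n → hit n (x + a)) (m+[n+1+o]≡1+m+[n+o] i a b)
  scoreWeight-north i x y a b true  = cong₂ hit (m+[n+1+o]≡1+m+[n+o] i a b) (+-suc y b)

  hit-origin : ∀ i v → q ^ δ v (i / 2 + 1) ≡ hit (i + 0) (v + 0)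
  hit-origin i v =
    trans (cong (q ^_) (δ-comm v (i / 2 + 1)))
          (cong₂ hit (sym (+-identityʳ i)) (sym (+-identityʳ v)))

  score≡pathWeight : ∀ i x y bs →
    q ^ correctFrom i (word x y bs) ≡ pathWeight (scoreWeight i x y) bs
  score≡pathWeight i x y []           = refl
  score≡pathWeight i x y (false ∷ bs) =
    trans (^-distribˡ-+-* q (δ x (i / 2 + 1)) _)
          (cong₂ _*_ (hit-origin i x)
                     (trans (score≡pathWeight (suc i) (suc x) y bs)
                            (pathWeight-cong (λ a b t → sym (scoreWeight-east i x y a b t)) bs)))
  score≡pathWeight i x y (true ∷ bs)  =
    trans (^-distribˡ-+-* q (δ y (i / 2 + 1)) _)
          (cong₂ _*_ (hit-origin i y)
                     (trans (score≡pathWeight (suc i) x (suc y) bs)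
                            (pathWeight-cong (λ a b t → sym (scoreWeight-north i x y a b t)) bs)))

module _ (q s : ℕ) where

  private
    w : Weight
    w = scoreWeight q 1 1 s

  G≡pathSum : ∀ a b → G a b s q ≡ pathSum w a b
  G≡pathSum a b =
    trans (cong sum (map-cong (score≡pathWeight q 1 1 s) (shuffles a b)))
          (sym (pathSum≡sum-pathWeight w a b))

  scoreWeight-last-north : ∀ a b → w a b true ≡ q ^ δ ((a + suc b) / 2 + 1) (s + suc b ∸ 1)
  scoreWeight-last-north a b =
    cong₂ (λ n v → q ^ δ (n / 2 + 1) v) (sym (+-suc a b)) (cong (_∸ 1) (sym (+-suc s b)))

  G-last-east : ∀ a → G (suc a) 0 s q ≡ q ^ δ ((suc a + 0) / 2 + 1) (suc a) * G a 0 s q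
  G-last-east a = begin
    G (suc a) 0 s q              ≡⟨ G≡pathSum (suc a) 0 ⟩
    pathSum w (suc a) 0          ≡⟨ pathSum-east w a ⟩
    w a 0 false * pathSum w a 0  ≡⟨ cong (w a 0 false *_) (G≡pathSum a 0) ⟨
    w a 0 false * G a 0 s q      ∎
    where open ≡-Reasoning

  G-last-north : ∀ b → G 0 (suc b) s q ≡ q ^ δ ((0 + suc b) / 2 + 1) (s + suc b ∸ 1) * G 0 b s q
  G-last-north b = begin
    G 0 (suc b) s q              ≡⟨ G≡pathSum 0 (suc b) ⟩
    pathSum w 0 (suc b)          ≡⟨ pathSum-north w b ⟩
    w 0 b true * pathSum w 0 b   ≡⟨ cong₂ _*_ (scoreWeight-last-north 0 b) (sym (G≡pathSum 0 b)) ⟩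
    _ ∎
    where open ≡-Reasoning

  G-last : ∀ a b → let cc = (suc a + suc b) / 2 + 1 in
    G (suc a) (suc b) s q
      ≡ q ^ δ cc (suc a) * G a (suc b) s q + q ^ δ cc (s + suc b ∸ 1) * G (suc a) b s q
  G-last a b = begin
    G (suc a) (suc b) s q        ≡⟨ G≡pathSum (suc a) (suc b) ⟩
    pathSum w (suc a) (suc b)    ≡⟨ pathSum-last w a b ⟩
    w a (suc b) false * pathSum w a (suc b) + w (suc a) b true * pathSum w (suc a) b
      ≡⟨ cong₂ _+_ (cong (w a (suc b) false *_) (sym (G≡pathSum a (suc b))))
                   (cong₂ _*_ (scoreWeight-last-north (suc a) b) (sym (G≡pathSum (suc a) b))) ⟩
    _ ∎
    where open ≡-Reasoning

m≡m+n*0 : ∀ m n → m ≡ m + n * 0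
m≡m+n*0 m n = sym (trans (cong (_+_ m) (*-zeroʳ n)) (+-identityʳ m))

m≡n*0+m : ∀ m n → m ≡ n * 0 + m
m≡n*0+m m n = cong (_+ m) (sym (*-zeroʳ n))

proposition1 : (a₁ a₂ s : ℕ) → s ≥ 1 → a₁ + a₂ ≥ 1 → (q : ℕ) →
    let cc = (a₁ + a₂) / 2 + 1 in
    (G a₁ a₂ s q
      ≡ q ^ δ cc a₁ * Gℤ (+ a₁ -ℤ + 1) (+ a₂) s q
        + q ^ δ cc (s + a₂ ∸ 1) * Gℤ (+ a₁) (+ a₂ -ℤ + 1) s q)
    × (G 0 0 s q ≡ 1)
proposition1 zero    zero    s _ () q
proposition1 (suc a) zero    s _ _  q =
  trans (G-last-east q s a) (m≡m+n*0 _ (q ^ δ ((suc a + 0) / 2 + 1) (s + 0 ∸ 1))) , refl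
proposition1 zero    (suc b) s _ _  q =
  trans (G-last-north q s b) (m≡n*0+m _ (q ^ δ ((0 + suc b) / 2 + 1) 0)) , refl
proposition1 (suc a) (suc b) s _ _  q = G-last q s a b , refl
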